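{- Let $w$ be a linearly recurrent infinite word. If there exist a constant $C>0$ and an integer $n_0$ such that for every $n\ge n_0$ one has $\sum_{m\le n}\mathrm{as}_w(m)\ge Cn^2$, then $w$ is uniformly abelian-square-rich (and hence abelian-square-rich).
   Context: An abelian square is a nonempty word $uv$ where $v$ is an anagram of $u$. For a finite or infinite word $w$, $\mathrm{as}_w(m)$ is the number of distinct factors of $w$ of length $m$ that are abelian squares. For a finite word $v$, $\mathrm{AS}(v)$ is the number of distinct factors of $v$ that are abelian squares. $p_w(n)$ is the number of distinct length-$n$ factors of $w$. The word $w$ is abelian-square-rich if there exist $C>0$ and $n_0$ such that for all $n\ge n_0$, $\frac{1}{p_w(n)}\sum_{v \text{ factor of } w,\,|v|=n}\mathrm{AS}(v)\ge Cn^2$; uniformly abelian-square-rich if there exist $C>0$ and $n_0$ with $\mathrm{AS}(v)\ge C|v|^2$ for all factors $v$ of $w$ with $|v|\ge n_0$. $w$ is linearly recurrent if there is a constant $K$ such that for every $n$, every factor of $w$ of length $Kn$ contains all factors of $w$ of length $n$. -}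

module Defs where

open import Data.Nat using (ℕ; _+_; _*_; _≤_)
open import Data.Fin using (Fin)
open import Data.List using (List; length; map; upTo; take; drop; _++_)
open import Data.Nat.ListAction using (sum)
open import Data.List.Membership.Propositional using (_∈_)
open import Data.List.Relation.Unary.Unique.Propositional using (Unique)
open import Data.List.Relation.Binary.Permutation.Propositional using (_↭_)
open import Data.Product using (_×_; ∃; ∃-syntax)
open import Function.Bundles using (_⇔_)
open import Relation.Binary.PropositionalEquality using (_≡_)

Word : ℕ → Set
Word k = List (Fin k)

InfWord : ℕ → Set
InfWord k = ℕ → Fin k

factorAt : ∀ {k} → InfWord k → ℕ → ℕ → Word k
factorAt w i n = map (λ j → w (i + j)) (upTo n)

IsFactor : ∀ {k} → InfWord k → Word k → Set
IsFactor w u = ∃[ i ] factorAt w i (length u) ≡ u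

IsFactorOf : ∀ {k} → Word k → Word k → Set
IsFactorOf x v = ∃[ a ] ∃[ b ] v ≡ a ++ (x ++ b)

IsAbelianSquare : ∀ {k} → Word k → Set
IsAbelianSquare x = ∃[ l ] (1 ≤ l × length x ≡ l + l × take l x ↭ drop l x)

HasCount : ∀ {A : Set} → (A → Set) → ℕ → Set
HasCount {A} P N = ∃[ L ] (Unique L × (∀ (x : A) → (x ∈ L) ⇔ P x) × length L ≡ N)

-- length-m factors of w that are abelian squares (counted by as_w(m))
ASFactorOfLength : ∀ {k} → InfWord k → ℕ → Word k → Set
ASFactorOfLength w m x = length x ≡ m × IsFactor w x × IsAbelianSquare x

-- factors of the finite word v that are abelian squares (counted by AS(v))
ASFactorOf : ∀ {k} → Word k → Word k → Set
ASFactorOf v x = IsFactorOf x v × IsAbelianSquare x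

-- length-n factors of w (counted by p_w(n))
FactorOfLength : ∀ {k} → InfWord k → ℕ → Word k → Set
FactorOfLength w n x = length x ≡ n × IsFactor w x

LinearlyRecurrent : ∀ {k} → InfWord k → Set
LinearlyRecurrent w =
  ∃[ K ] (∀ n i u → FactorOfLength w n u →
            ∃[ j ] (j + n ≤ K * n × factorAt w (i + j) n ≡ u))

sumUpTo : (ℕ → ℕ) → ℕ → ℕ
sumUpTo c n = sum (map c (upTo (n + 1)))

-- uniformly abelian-square-rich, with C = p / q > 0
UniformlyASRich : ∀ {k} → InfWord k → Set
UniformlyASRich {k} w =
  ∃[ p ] ∃[ q ] ∃[ n₀ ] (1 ≤ p × 1 ≤ q ×
    (∀ (v : Word k) → IsFactor w v → n₀ ≤ length v →
       ∃[ N ] (HasCount (ASFactorOf v) N × p * (length v * length v) ≤ q * N)))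

-- abelian-square-rich, with C = p / q > 0:
-- (1/p_w(n)) Σ_{|v| = n} AS(v) ≥ C n², where L lists the length-n factors without
-- repetition (so p_w(n) = length L) and a v = AS(v)
ASRich : ∀ {k} → InfWord k → Set
ASRich {k} w =
  ∃[ p ] ∃[ q ] ∃[ n₀ ] (1 ≤ p × 1 ≤ q ×
    (∀ n → n₀ ≤ n →
       ∃[ L ] (Unique L × (∀ (x : Word k) → (x ∈ L) ⇔ FactorOfLength w n x) ×
         ∃[ a ] ((∀ v → v ∈ L → HasCount (ASFactorOf v) (a v)) ×
           p * (n * n) * length L ≤ q * sum (map a L)))))

-- Let K be a recurrence constant of w and put K' = K + 1.  Take a factor v
-- of w of length ℓ ≥ (n₀ + 1) K' and set n = ℓ / K'.  Then n ≥ n₀ + 1,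
-- K n ≤ ℓ and ℓ ≤ 2 K' n.  By linear recurrence every factor of w of length
-- m ≤ n occurs inside v (v has length ≥ K m), so every abelian square of w of
-- length ≤ n is a factor of v; these squares are counted by Σ_{m ≤ n} as_w(m),
-- hence AS(v) ≥ Σ_{m ≤ n} as_w(m) ≥ (p/q) n² ≥ (p / (q (2K')²)) ℓ².
-- Averaging this uniform bound over the (finitely many) length-n factors of
-- w gives abelian-square-richness.
module Submission where

open import Defs
open import Data.Nat using (ℕ; zero; suc; _+_; _*_; _∸_; _≤_; _<_; z≤n; s≤s; _≤?_)
open import Data.Nat.Properties
open import Data.Nat.DivMod using (_/_; _%_; m*n/n≡m; /-monoˡ-≤; m/n*n≤m; m≡m%n+[m/n]*n; m%n<n)
open import Data.Nat.ListAction using (sum)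
open import Data.Nat.ListAction.Properties using (sum-++)
open import Data.Nat.Tactic.RingSolver using (solve-∀)
import Data.Fin as Fin
open import Data.List using (applyUpTo; List; []; _∷_; [_]; length; map; upTo; take; drop; _++_; filter; deduplicate)
open import Data.List.Properties using (≡-dec; length-++; map-++; map-upTo; map-applyUpTo; map-cong; upTo-∷ʳ; length-map; length-upTo)
open import Data.List.Membership.Propositional using (_∈_)
open import Data.List.Membership.Propositional.Properties
  using (∈-∃++; ∈-++⁺ˡ; ∈-++⁺ʳ; ∈-++⁻; ∈-map⁺; ∈-map⁻; ∈-filter⁺; ∈-filter⁻; ∈-deduplicate⁺; ∈-deduplicate⁻; ∈-upTo⁺)
open import Data.List.Relation.Unary.Any using (here; there)
import Data.List.Relation.Unary.All as All
open import Data.List.Relation.Unary.Unique.Propositional using (Unique; []; _∷_)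
open import Data.List.Relation.Unary.Unique.Propositional.Properties using (++⁺)
open import Data.List.Relation.Unary.Unique.DecPropositional.Properties using (deduplicate-!)
open import Data.List.Relation.Binary.Permutation.Propositional using (_↭_; prep; ↭-sym; ↭-refl; ↭-trans)
open import Data.List.Relation.Binary.Permutation.Propositional.Properties using (∈-resp-↭; shift; drop-mid; ↭-length)
open import Data.Product using (_×_; _,_; ∃-syntax; proj₁)
open import Data.Sum using (inj₁; inj₂)
open import Data.Empty using (⊥-elim)
open import Function using (_∘′_)
open import Function.Bundles using (_⇔_; mk⇔; Equivalence)
open import Relation.Binary.Definitions using (DecidableEquality)
open import Relation.Binary.PropositionalEquality using (_≡_; refl; sym; trans; cong; cong₂; subst; subst₂; module ≡-Reasoning)
open import Relation.Nullary using (Dec; yes; no)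
open import Relation.Nullary.Decidable using (_×-dec_; map′)

unique-⊆-length : ∀ {A : Set} (xs ys : List A) → Unique xs →
                  (∀ {x} → x ∈ xs → x ∈ ys) → length xs ≤ length ys
unique-⊆-length [] ys _ _ = z≤n
unique-⊆-length (x ∷ xs) ys (x∉xs ∷ uxs) xs⊆ys with ∈-∃++ (xs⊆ys (here refl))
... | (ys₁ , ys₂ , refl) =
  subst (suc (length xs) ≤_) (sym length-split)
    (s≤s (unique-⊆-length xs (ys₁ ++ ys₂) uxs xs⊆rest))
  where
  length-split : length (ys₁ ++ x ∷ ys₂) ≡ suc (length (ys₁ ++ ys₂))
  length-split = begin
    length (ys₁ ++ x ∷ ys₂)          ≡⟨ length-++ ys₁ ⟩
    length ys₁ + suc (length ys₂)    ≡⟨ +-suc (length ys₁) (length ys₂) ⟩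
    suc (length ys₁ + length ys₂)    ≡⟨ cong suc (sym (length-++ ys₁)) ⟩
    suc (length (ys₁ ++ ys₂))        ∎
    where open ≡-Reasoning
  -- since x does not occur in xs, xs lies in ys with x removed
  xs⊆rest : ∀ {z} → z ∈ xs → z ∈ ys₁ ++ ys₂
  xs⊆rest z∈xs with ∈-++⁻ ys₁ (xs⊆ys (there z∈xs))
  ... | inj₁ z∈ys₁ = ∈-++⁺ˡ z∈ys₁
  ... | inj₂ (here refl) = ⊥-elim (All.lookup x∉xs z∈xs refl)
  ... | inj₂ (there z∈ys₂) = ∈-++⁺ʳ ys₁ z∈ys₂

HasCount-unique : ∀ {A : Set} {P : A → Set} {M N : ℕ} → HasCount P M → HasCount P N → M ≡ N
HasCount-unique (xs , uxs , xs⇔P , refl) (ys , uys , ys⇔P , refl) =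
  ≤-antisym (unique-⊆-length xs ys uxs (λ {x} → Equivalence.from (ys⇔P x) ∘′ Equivalence.to (xs⇔P x)))
            (unique-⊆-length ys xs uys (λ {x} → Equivalence.from (xs⇔P x) ∘′ Equivalence.to (ys⇔P x)))

sum-upTo-suc : ∀ (c : ℕ → ℕ) N → sum (map c (upTo (suc N))) ≡ sum (map c (upTo N)) + c N
sum-upTo-suc c N = begin
  sum (map c (upTo (suc N)))              ≡⟨ cong (sum ∘′ map c) (sym (upTo-∷ʳ N)) ⟩
  sum (map c (upTo N ++ [ N ]))           ≡⟨ cong sum (map-++ c (upTo N) [ N ]) ⟩
  sum (map c (upTo N) ++ [ c N ])         ≡⟨ sum-++ (map c (upTo N)) [ c N ] ⟩
  sum (map c (upTo N)) + (c N + 0)        ≡⟨ cong (sum (map c (upTo N)) +_) (+-identityʳ (c N)) ⟩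
  sum (map c (upTo N)) + c N              ∎
  where open ≡-Reasoning

count-by-size : ∀ {A : Set} (size : A → ℕ) (P : A → Set) (c : ℕ → ℕ) N →
                (∀ m → m < N → HasCount (λ x → size x ≡ m × P x) (c m)) →
                ∃[ xs ] (Unique xs × (∀ {x} → x ∈ xs → size x < N × P x) ×
                         length xs ≡ sum (map c (upTo N)))
count-by-size size P c zero counts = [] , [] , (λ ()) , refl
count-by-size size P c (suc N) counts
  with count-by-size size P c N (λ m m<N → counts m (m<n⇒m<1+n m<N))
     | counts N ≤-refl
... | (xs , uxs , xs-small , |xs|) | (ys , uys , ys⇔ , |ys|) =
  xs ++ ys , ++⁺ uxs uys disjoint , sound , length-union
  where
  -- elements of xs are smaller than N, elements of ys have size N
  disjoint : ∀ {x} → x ∈ xs × x ∈ ys → _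
  disjoint (x∈xs , x∈ys) = <-irrefl (proj₁ (Equivalence.to (ys⇔ _) x∈ys)) (proj₁ (xs-small x∈xs))
  sound : ∀ {x} → x ∈ xs ++ ys → size x < suc N × P x
  sound {x} x∈ with ∈-++⁻ xs x∈
  ... | inj₁ x∈xs = let (lt , px) = xs-small x∈xs in m<n⇒m<1+n lt , px
  ... | inj₂ x∈ys = let (eq , px) = Equivalence.to (ys⇔ x) x∈ys in s≤s (≤-reflexive eq) , px
  length-union : length (xs ++ ys) ≡ sum (map c (upTo (suc N)))
  length-union = trans (length-++ xs) (trans (cong₂ _+_ |xs| |ys|) (sym (sum-upTo-suc c N)))

sum-lowerBound : ∀ {A : Set} (B Q : ℕ) (a : A → ℕ) (L : List A) →
                 (∀ v → v ∈ L → B ≤ Q * a v) → B * length L ≤ Q * sum (map a L)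
sum-lowerBound B Q a [] bound = ≤-reflexive (trans (*-zeroʳ B) (sym (*-zeroʳ Q)))
sum-lowerBound B Q a (v ∷ L) bound =
  subst₂ _≤_ (sym (*-suc B (length L))) (sym (*-distribˡ-+ Q (a v) (sum (map a L))))
    (+-mono-≤ (bound v (here refl)) (sum-lowerBound B Q a L (λ u u∈L → bound u (there u∈L))))

module _ {A : Set} (_≟_ : DecidableEquality A) where

  open import Data.List.Membership.DecPropositional _≟_ using (_∈?_)

  _↭?_ : (xs ys : List A) → Dec (xs ↭ ys)
  [] ↭? [] = yes ↭-refl
  [] ↭? (y ∷ ys) = no (λ p → 0≢1+n (↭-length p))
  (x ∷ xs) ↭? ys with x ∈? ys
  ... | no x∉ys = no (λ p → x∉ys (∈-resp-↭ p (here refl)))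
  ... | yes x∈ys with ∈-∃++ x∈ys
  ... | (ys₁ , ys₂ , refl) with xs ↭? (ys₁ ++ ys₂)
  ... | yes p = yes (↭-trans (prep x p) (↭-sym (shift x ys₁ ys₂)))
  ... | no ¬p = no (λ p → ¬p (drop-mid [] ys₁ p))

module _ {A : Set} where

  prefixes : List A → List (List A)
  prefixes [] = [ [] ]
  prefixes (a ∷ v) = [] ∷ map (a ∷_) (prefixes v)

  factors : List A → List (List A)
  factors [] = prefixes []
  factors (a ∷ v) = prefixes (a ∷ v) ++ factors v

  prefixes-sound : ∀ v {x} → x ∈ prefixes v → ∃[ b ] (v ≡ x ++ b)
  prefixes-sound [] (here refl) = [] , refl
  prefixes-sound (a ∷ v) (here refl) = a ∷ v , refl
  prefixes-sound (a ∷ v) (there x∈) with ∈-map⁻ (a ∷_) x∈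
  ... | (y , y∈ , refl) = let (b , eq) = prefixes-sound v y∈ in b , cong (a ∷_) eq

  prefixes-complete : ∀ x b → x ∈ prefixes (x ++ b)
  prefixes-complete [] [] = here refl
  prefixes-complete [] (c ∷ b) = here refl
  prefixes-complete (a ∷ x) b = there (∈-map⁺ (a ∷_) (prefixes-complete x b))

  prefixes⊆factors : ∀ v {x} → x ∈ prefixes v → x ∈ factors v
  prefixes⊆factors [] x∈ = x∈
  prefixes⊆factors (a ∷ v) x∈ = ∈-++⁺ˡ x∈

  factors-sound : ∀ v {x} → x ∈ factors v → ∃[ a ] ∃[ b ] (v ≡ a ++ (x ++ b))
  factors-sound [] x∈ = [] , prefixes-sound [] x∈
  factors-sound (c ∷ v) x∈ with ∈-++⁻ (prefixes (c ∷ v)) x∈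
  ... | inj₁ x∈pre = [] , prefixes-sound (c ∷ v) x∈pre
  ... | inj₂ x∈fac = let (a , b , eq) = factors-sound v x∈fac in c ∷ a , b , cong (c ∷_) eq

  factors-complete : ∀ a x b → x ∈ factors (a ++ (x ++ b))
  factors-complete [] x b = prefixes⊆factors (x ++ b) (prefixes-complete x b)
  factors-complete (c ∷ a) x b = ∈-++⁺ʳ (prefixes (c ∷ a ++ (x ++ b))) (factors-complete a x b)

module _ {k : ℕ} where

  _≟ʷ_ : DecidableEquality (Word k)
  _≟ʷ_ = ≡-dec Fin._≟_

  -- A word x is an abelian square iff some half-length l < |x| + 1 works,
  -- so a bounded search decides it.
  isAbelianSquare? : (x : Word k) → Dec (IsAbelianSquare x)
  isAbelianSquare? x =
    map′ (λ (l , _ , sq) → l , sq)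
         (λ (l , sq@(_ , |x|≡l+l , _)) → l , s≤s (subst (l ≤_) (sym |x|≡l+l) (m≤m+n l l)) , sq)
         (anyUpTo? (λ l → (1 ≤? l) ×-dec ((length x ≟ l + l) ×-dec (_↭?_ Fin._≟_ (take l x) (drop l x))))
                   (suc (length x)))

  asFactors : Word k → List (Word k)
  asFactors v = deduplicate _≟ʷ_ (filter isAbelianSquare? (factors v))

  AS : Word k → ℕ
  AS v = length (asFactors v)

  asFactors-spec : ∀ v x → (x ∈ asFactors v) ⇔ ASFactorOf v x
  asFactors-spec v x = mk⇔ sound complete
    where
    sound : x ∈ asFactors v → ASFactorOf v x
    sound x∈ = let (x∈fac , sq) = ∈-filter⁻ isAbelianSquare? (∈-deduplicate⁻ _≟ʷ_ _ x∈)
               in factors-sound v x∈fac , sq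
    complete : ASFactorOf v x → x ∈ asFactors v
    complete ((a , b , refl) , sq) = ∈-deduplicate⁺ _≟ʷ_ (∈-filter⁺ isAbelianSquare? (factors-complete a x b) sq)

  AS-count : ∀ v → HasCount (ASFactorOf v) (AS v)
  AS-count v = asFactors v , deduplicate-! _≟ʷ_ _ , asFactors-spec v , refl

module _ {k : ℕ} (w : InfWord k) where

  length-factorAt : ∀ i n → length (factorAt w i n) ≡ n
  length-factorAt i n = trans (length-map _ (upTo n)) (length-upTo n)

  factorAt-suc : ∀ i n → factorAt w i (suc n) ≡ w i ∷ factorAt w (suc i) n
  factorAt-suc i n = cong₂ _∷_ (cong w (+-identityʳ i)) (begin
    map (λ j → w (i + j)) (applyUpTo suc n)   ≡⟨ map-applyUpTo suc _ n ⟩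
    applyUpTo (λ j → w (i + suc j)) n         ≡⟨ sym (map-upTo _ n) ⟩
    map (λ j → w (i + suc j)) (upTo n)        ≡⟨ map-cong (λ j → cong w (+-suc i j)) (upTo n) ⟩
    map (λ j → w (suc i + j)) (upTo n)        ∎)
    where open ≡-Reasoning

  factorAt-++ : ∀ i a b → factorAt w i (a + b) ≡ factorAt w i a ++ factorAt w (i + a) b
  factorAt-++ i zero b = cong (λ t → factorAt w t b) (sym (+-identityʳ i))
  factorAt-++ i (suc a) b = begin
    factorAt w i (suc (a + b))                                 ≡⟨ factorAt-suc i (a + b) ⟩
    w i ∷ factorAt w (suc i) (a + b)                           ≡⟨ cong (w i ∷_) (factorAt-++ (suc i) a b) ⟩
    w i ∷ (factorAt w (suc i) a ++ factorAt w (suc i + a) b)   ≡⟨ cong (λ t → w i ∷ (factorAt w (suc i) a ++ factorAt w t b)) (sym (+-suc i a)) ⟩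
    (w i ∷ factorAt w (suc i) a) ++ factorAt w (i + suc a) b   ≡⟨ cong (_++ factorAt w (i + suc a) b) (sym (factorAt-suc i a)) ⟩
    factorAt w i (suc a) ++ factorAt w (i + suc a) b           ∎
    where open ≡-Reasoning

  factorAt-inWindow : ∀ i j m ℓ → j + m ≤ ℓ → IsFactorOf (factorAt w (i + j) m) (factorAt w i ℓ)
  factorAt-inWindow i j m ℓ j+m≤ℓ = factorAt w i j , factorAt w (i + j + m) r , (begin
    factorAt w i ℓ                                                          ≡⟨ cong (factorAt w i) (sym ℓ≡j+m+r) ⟩
    factorAt w i (j + (m + r))                                              ≡⟨ factorAt-++ i j (m + r) ⟩
    factorAt w i j ++ factorAt w (i + j) (m + r)                            ≡⟨ cong (factorAt w i j ++_) (factorAt-++ (i + j) m r) ⟩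
    factorAt w i j ++ (factorAt w (i + j) m ++ factorAt w (i + j + m) r)    ∎)
    where
    open ≡-Reasoning
    r = ℓ ∸ (j + m)
    ℓ≡j+m+r : j + (m + r) ≡ ℓ
    ℓ≡j+m+r = trans (sym (+-assoc j m r)) (m+[n∸m]≡n j+m≤ℓ)

quotient-scale : ∀ n₀ K ℓ → suc n₀ * suc K ≤ ℓ →
                 suc n₀ ≤ ℓ / suc K × K * (ℓ / suc K) ≤ ℓ × ℓ ≤ (suc K + suc K) * (ℓ / suc K)
quotient-scale n₀ K ℓ bigℓ = n₀<n , Kn≤ℓ , ℓ≤2K'n
  where
  K' = suc K
  n = ℓ / K'
  n₀<n : suc n₀ ≤ n
  n₀<n = subst (_≤ n) (m*n/n≡m (suc n₀) K') (/-monoˡ-≤ K' bigℓ)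
  nK'≤ℓ : n * K' ≤ ℓ
  nK'≤ℓ = m/n*n≤m ℓ K'
  Kn≤ℓ : K * n ≤ ℓ
  Kn≤ℓ = ≤-trans (m≤n+m (K * n) n) (≤-trans (≤-reflexive (*-comm K' n)) nK'≤ℓ)
  -- the remainder ℓ % K' is below K' ≤ n K', because n ≥ 1
  remainder≤nK' : ℓ % K' ≤ n * K'
  remainder≤nK' = ≤-trans (<⇒≤ (m%n<n ℓ K')) (subst (_≤ n * K') (*-identityˡ K') (*-monoˡ-≤ K' (≤-trans (s≤s z≤n) n₀<n)))
  double : ∀ K n → n * suc K + n * suc K ≡ (suc K + suc K) * n
  double = solve-∀
  ℓ≤2K'n : ℓ ≤ (K' + K') * n
  ℓ≤2K'n = begin
    ℓ                   ≡⟨ m≡m%n+[m/n]*n ℓ K' ⟩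
    ℓ % K' + n * K'     ≤⟨ +-monoˡ-≤ (n * K') remainder≤nK' ⟩
    n * K' + n * K'     ≡⟨ double K n ⟩
    (K' + K') * n       ∎
    where open ≤-Reasoning

quadratic-rescale : ∀ p q D n ℓ N → ℓ ≤ D * n → p * (n * n) ≤ q * N → p * (ℓ * ℓ) ≤ (D * D * q) * N
quadratic-rescale p q D n ℓ N ℓ≤Dn pn²≤qN = begin
  p * (ℓ * ℓ)                ≤⟨ *-monoʳ-≤ p (*-mono-≤ ℓ≤Dn ℓ≤Dn) ⟩
  p * ((D * n) * (D * n))    ≡⟨ regroup₁ p D n ⟩
  D * D * (p * (n * n))      ≤⟨ *-monoʳ-≤ (D * D) pn²≤qN ⟩
  D * D * (q * N)            ≡⟨ regroup₂ D q N ⟩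
  D * D * q * N              ∎
  where
  open ≤-Reasoning
  regroup₁ : ∀ p D n → p * ((D * n) * (D * n)) ≡ D * D * (p * (n * n))
  regroup₁ = solve-∀
  regroup₂ : ∀ D q N → D * D * (q * N) ≡ D * D * q * N
  regroup₂ = solve-∀

ManyShortAbelianSquares : ∀ {k} → InfWord k → ℕ → ℕ → ℕ → Set
ManyShortAbelianSquares w p q n₀ =
  ∀ n → n₀ ≤ n → ∃[ c ] ((∀ m → m ≤ n → HasCount (ASFactorOfLength w m) (c m)) × p * (n * n) ≤ q * sumUpTo c n)

RecurrentWith : ∀ {k} → InfWord k → ℕ → Set
RecurrentWith w K = ∀ n i u → FactorOfLength w n u → ∃[ j ] (j + n ≤ K * n × factorAt w (i + j) n ≡ u)

-- The lengths counted by sumUpTo c n are those below n + 1.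
m<n+1⇒m≤n : ∀ {m n} → m < n + 1 → m ≤ n
m<n+1⇒m≤n {m} {n} m<n+1 = ≤-pred (subst (m <_) (+-comm n 1) m<n+1)

module _ {k : ℕ} (w : InfWord k) {K : ℕ} (recurrent : RecurrentWith w K) where

  factor-inLongFactor : ∀ u v → IsFactor w u → IsFactor w v → K * length u ≤ length v → IsFactorOf u v
  factor-inLongFactor u v (_ , u-at) (i , v-at) K|u|≤|v|
    with recurrent (length u) i u (refl , (_ , u-at))
  ... | (j , j+|u|≤K|u| , u-at-i+j) =
    subst₂ IsFactorOf u-at-i+j v-at
      (factorAt-inWindow w i j (length u) (length v) (≤-trans j+|u|≤K|u| K|u|≤|v|))

  -- Finitely many factors of each length: they all start before position K n + 1.
  factorsOfLength-finite : ∀ n → ∃[ L ] (Unique L × (∀ x → (x ∈ L) ⇔ FactorOfLength w n x))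
  factorsOfLength-finite n = deduplicate _≟ʷ_ windows , deduplicate-! _≟ʷ_ windows , λ x → mk⇔ sound complete
    where
    windows : List (Word k)
    windows = map (λ i → factorAt w i n) (upTo (suc (K * n)))
    sound : ∀ {x} → x ∈ deduplicate _≟ʷ_ windows → FactorOfLength w n x
    sound x∈ with ∈-map⁻ (λ i → factorAt w i n) (∈-deduplicate⁻ _≟ʷ_ windows x∈)
    ... | (i , _ , refl) = length-factorAt w i n , i , cong (factorAt w i) (length-factorAt w i n)
    complete : ∀ {x} → FactorOfLength w n x → x ∈ deduplicate _≟ʷ_ windows
    complete {x} x-factor with recurrent n 0 x x-factor
    ... | (j , j+n≤Kn , refl) =
      ∈-deduplicate⁺ _≟ʷ_ (∈-map⁺ (λ i → factorAt w i n) (∈-upTo⁺ (s≤s (≤-trans (m≤m+n j n) j+n≤Kn))))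

  -- Key estimate: a factor v of w with |v| ≥ K n contains every abelian
  -- square of w of length ≤ n, so AS(v) ≥ Σ_{m ≤ n} as_w(m).
  AS-lowerBound : ∀ n c → (∀ m → m ≤ n → HasCount (ASFactorOfLength w m) (c m)) →
                  ∀ v → IsFactor w v → K * n ≤ length v → sumUpTo c n ≤ AS v
  AS-lowerBound n c counts v v-factor Kn≤|v|
    with count-by-size length (λ x → IsFactor w x × IsAbelianSquare x) c (n + 1)
                       (λ m m<n+1 → counts m (m<n+1⇒m≤n m<n+1))
  ... | (squares , unique , squares-sound , |squares|) =
    subst (_≤ AS v) |squares| (unique-⊆-length squares (asFactors v) unique squares⊆asFactors)
    where
    squares⊆asFactors : ∀ {x} → x ∈ squares → x ∈ asFactors v
    squares⊆asFactors {x} x∈ with squares-sound x∈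
    ... | (|x|<n+1 , x-factor , square) =
      Equivalence.from (asFactors-spec v x)
        (factor-inLongFactor x v x-factor v-factor (≤-trans (*-monoʳ-≤ K (m<n+1⇒m≤n |x|<n+1)) Kn≤|v|) , square)

  AS-quadratic : ∀ p q n₀ → ManyShortAbelianSquares w p q n₀ →
                 ∀ v → IsFactor w v → suc n₀ * suc K ≤ length v →
                 p * (length v * length v) ≤ ((suc K + suc K) * (suc K + suc K) * q) * AS v
  AS-quadratic p q n₀ many v v-factor bigv
    with quotient-scale n₀ K (length v) bigv
  ... | (n₀<n , Kn≤|v| , |v|≤2K'n)
    with many (length v / suc K) (≤-trans (n≤1+n n₀) n₀<n)
  ... | (c , counts , pn²≤qS) =
    quadratic-rescale p q (suc K + suc K) (length v / suc K) (length v) (AS v) |v|≤2K'n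
      (≤-trans pn²≤qS (*-monoʳ-≤ q (AS-lowerBound (length v / suc K) c counts v v-factor Kn≤|v|)))

-- Uniform richness implies richness as soon as each length has finitely
-- many factors: average the uniform bound over the factors of length n.
uniform⇒rich : ∀ {k} (w : InfWord k) →
               (∀ n → ∃[ L ] (Unique L × (∀ x → (x ∈ L) ⇔ FactorOfLength w n x))) →
               UniformlyASRich w → ASRich w
uniform⇒rich w finite (p , q , n₀ , 1≤p , 1≤q , uniform) =
  p , q , n₀ , 1≤p , 1≤q , λ n n₀≤n →
    let (L , unique , L⇔) = finite n in
    L , unique , L⇔ , AS , (λ v _ → AS-count v) ,
    sum-lowerBound (p * (n * n)) q AS L (λ v v∈L → bound v (Equivalence.to (L⇔ v) v∈L) n₀≤n)
  where
  -- the count guaranteed by uniform richness is AS(v)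
  bound : ∀ {n} v → FactorOfLength w n v → n₀ ≤ n → p * (n * n) ≤ q * AS v
  bound v (refl , v-factor) n₀≤|v| with uniform v v-factor n₀≤|v|
  ... | (N , count , pℓ²≤qN) = subst (λ t → p * _ ≤ q * t) (HasCount-unique count (AS-count v)) pℓ²≤qN

lemma3 : ∀ {k : ℕ} (w : InfWord k) → LinearlyRecurrent w →
         (∃[ p ] ∃[ q ] ∃[ n₀ ] (1 ≤ p × 1 ≤ q ×
            (∀ n → n₀ ≤ n → ∃[ c ] ((∀ m → m ≤ n → HasCount (ASFactorOfLength w m) (c m)) ×
               p * (n * n) ≤ q * sumUpTo c n)))) →
         UniformlyASRich w × ASRich w
lemma3 w (K , recurrent) (p , q , n₀ , 1≤p , 1≤q , many) =
  uniform , uniform⇒rich w (factorsOfLength-finite w {K} recurrent) uniform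
  where
  D : ℕ
  D = suc K + suc K
  -- C = p / (q D²) and threshold (n₀ + 1)(K + 1), by AS-quadratic
  uniform : UniformlyASRich w
  uniform = p , D * D * q , suc n₀ * suc K , 1≤p , *-mono-≤ {1} {D * D} (s≤s z≤n) 1≤q ,
            λ v v-factor bigv → AS v , AS-count v , AS-quadratic w {K} recurrent p q n₀ many v v-factor bigv
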